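{- Let $L\geq 3$ be an integer and define \[ G_{L,2}(q)=\frac{q^2}{(q^2;q)_{L+1}}-\sum_{n\geq1}\frac{q^{3n}}{1-q^n}{L+n-1\brack n-1}_q,\qquad H^*_{L,2}(q)=\frac{q^2(1-q^L)}{(q^2;q)_{L+1}}-\left(\frac{1}{(q^3;q)_L}-1\right). \] Then $G_{L,2}(q)=\dfrac{H^*_{L,2}(q)}{1-q^L}$.
   Context: $(a;q)_n=\prod_{i=0}^{n-1}(1-aq^i)$ and ${m\brack k}_q=\frac{(q;q)_m}{(q;q)_k(q;q)_{m-k}}$ is the $q$-binomial coefficient. -}

module Defs where

-- Formal power series in q with integer coefficients, represented by their
-- coefficient functions: f n = coefficient of q^n.

open import Data.Nat as ℕ using (ℕ; zero; suc; _∸_; _≡ᵇ_)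
open import Data.Integer using (ℤ; 0ℤ; 1ℤ; _+_; _-_; _*_; -_)
open import Data.Bool using (if_then_else_)

PS : Set
PS = ℕ → ℤ

sumBelow : ℕ → (ℕ → ℤ) → ℤ
sumBelow zero    f = 0ℤ
sumBelow (suc n) f = sumBelow n f + f n

const : ℤ → PS
const c n = if n ≡ᵇ 0 then c else 0ℤ

𝟙 : PS
𝟙 = const 1ℤ

q^ : ℕ → PS
q^ k n = if n ≡ᵇ k then 1ℤ else 0ℤ

infixl 6 _⊕_ _⊖_
infixl 7 _⊛_

_⊕_ : PS → PS → PS
(f ⊕ g) n = f n + g n

_⊖_ : PS → PS → PS
(f ⊖ g) n = f n - g n

_⊛_ : PS → PS → PS
(f ⊛ g) n = sumBelow (suc n) (λ i → f i * g (n ∸ i))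

-- Multiplicative inverse 1/f of a series f with constant term 1, via the
-- standard recursion g 0 = 1, g m = - Σ_{i=1}^{m} f i * g (m - i).
-- invUpTo f n agrees with 1/f on coefficients 0..n.
invUpTo : PS → ℕ → PS
invUpTo f zero    = 𝟙
invUpTo f (suc n) i =
  if i ≡ᵇ suc n
  then - sumBelow (suc n) (λ j → f (suc j) * invUpTo f n (suc n ∸ suc j))
  else invUpTo f n i

inv : PS → PS
inv f n = invUpTo f n n

poch : PS → ℕ → PS
poch a zero    = 𝟙
poch a (suc n) = poch a n ⊛ (𝟙 ⊖ a ⊛ q^ n)

qbin : ℕ → ℕ → PS
qbin m k = poch (q^ 1) m ⊛ inv (poch (q^ 1) k) ⊛ inv (poch (q^ 1) (m ∸ k))

-- Sum Σ_{n ≥ 1} t n of a family whose n-th term has q-adic valuation ≥ n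
-- (so the sum is a well-defined formal power series): the coefficient of
-- q^N only receives contributions from 1 ≤ n ≤ N.
sumFrom1 : (ℕ → PS) → PS
sumFrom1 t N = sumBelow N (λ j → t (suc j) N)

G : ℕ → PS
G L = q^ 2 ⊛ inv (poch (q^ 2) (suc L))
      ⊖ sumFrom1 (λ n → q^ (3 ℕ.* n) ⊛ inv (𝟙 ⊖ q^ n) ⊛ qbin (L ℕ.+ n ∸ 1) (n ∸ 1))

H* : ℕ → PS
H* L = q^ 2 ⊛ (𝟙 ⊖ q^ L) ⊛ inv (poch (q^ 2) (suc L))
       ⊖ (inv (poch (q^ 3) L) ⊖ 𝟙)

module Submission where

-- Writing T_L = Σ_{n≥1} q^{3n}/(1-q^n) [L+n-1, n-1]_q, the theorem says
-- (1 - q^L) G_{L,2} = H*_{L,2}, i.e. (1 - q^L) T_L = 1/(q^3;q)_L - 1.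
-- Putting L = l+1 and n = m+1, the absorption identity for q-binomials turns
-- the n-th summand of (1 - q^{l+1}) T_L into q^{3n} [l+n, n]_q, so the claim
-- is the tail (m ≥ 1) of the q-binomial theorem
--     Σ_{m≥0} x^m [l+m, m]_q = 1/(x;q)_{l+1}      for x = q^a, a ≥ 1.

open import Defs
open import Data.Nat as ℕ using (ℕ; zero; suc; _≤_; _<_; z≤n; s≤s; _∸_; _≡ᵇ_; NonZero)
import Data.Nat.Properties as ℕP
open import Data.Nat.Tactic.RingSolver using () renaming (solve-∀ to ℕ-solve)
open import Data.Integer as ℤ using (ℤ; 0ℤ; 1ℤ; _+_; _-_; _*_; -_)
import Data.Integer.Properties as ℤP
open import Data.Integer.Tactic.RingSolver using () renaming (solve-∀ to ℤ-solve)
open import Data.Bool using (true; false)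
open import Data.Maybe using (Maybe; just; nothing)
open import Data.Product using (_,_)
open import Data.Sum using (inj₁; inj₂)
open import Level using (0ℓ)
open import Relation.Nullary using (yes; no)
open import Relation.Binary.PropositionalEquality
  using (_≡_; refl; sym; trans; cong; cong₂; module ≡-Reasoning)
open import Relation.Binary.Bundles using (Setoid)
import Relation.Binary.Structures as B
import Relation.Binary.Reasoning.Setoid as SetoidReasoning
open import Algebra.Bundles using (RawRing; CommutativeRing)
import Algebra.Solver.Ring.AlmostCommutativeRing as ACR

sum-cong : ∀ n {f g : ℕ → ℤ} → (∀ i → i < n → f i ≡ g i) → sumBelow n f ≡ sumBelow n g
sum-cong zero    h = refl
sum-cong (suc n) h = cong₂ _+_ (sum-cong n (λ i i<n → h i (ℕP.m<n⇒m<1+n i<n))) (h n ℕP.≤-refl)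

sum-ext : ∀ n {f g : ℕ → ℤ} → (∀ i → f i ≡ g i) → sumBelow n f ≡ sumBelow n g
sum-ext n h = sum-cong n (λ i _ → h i)

sum-zero : ∀ n {f : ℕ → ℤ} → (∀ i → i < n → f i ≡ 0ℤ) → sumBelow n f ≡ 0ℤ
sum-zero zero    h = refl
sum-zero (suc n) h = cong₂ _+_ (sum-zero n (λ i i<n → h i (ℕP.m<n⇒m<1+n i<n))) (h n ℕP.≤-refl)

sum-+ : ∀ n (f g : ℕ → ℤ) → sumBelow n (λ i → f i + g i) ≡ sumBelow n f + sumBelow n g
sum-+ zero    f g = refl
sum-+ (suc n) f g = trans (cong (_+ (f n + g n)) (sum-+ n f g))
                          (interchange (sumBelow n f) (sumBelow n g) (f n) (g n))
  where
  interchange : ∀ a b c d → (a + b) + (c + d) ≡ (a + c) + (b + d)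
  interchange = ℤ-solve

sum-*ˡ : ∀ n c (f : ℕ → ℤ) → c * sumBelow n f ≡ sumBelow n (λ i → c * f i)
sum-*ˡ zero    c f = ℤP.*-zeroʳ c
sum-*ˡ (suc n) c f = trans (ℤP.*-distribˡ-+ c (sumBelow n f) (f n)) (cong (_+ c * f n) (sum-*ˡ n c f))

sum-*ʳ : ∀ n c (f : ℕ → ℤ) → sumBelow n f * c ≡ sumBelow n (λ i → f i * c)
sum-*ʳ n c f = trans (ℤP.*-comm (sumBelow n f) c)
                     (trans (sum-*ˡ n c f) (sum-ext n (λ i → ℤP.*-comm c (f i))))

sum-front : ∀ n (f : ℕ → ℤ) → sumBelow (suc n) f ≡ f 0 + sumBelow n (λ i → f (suc i))
sum-front zero    f = ℤP.+-comm 0ℤ (f 0)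
sum-front (suc n) f = trans (cong (_+ f (suc n)) (sum-front n f)) (ℤP.+-assoc (f 0) _ _)

sum-swap : ∀ n m (F : ℕ → ℕ → ℤ) →
           sumBelow n (λ i → sumBelow m (F i)) ≡ sumBelow m (λ j → sumBelow n (λ i → F i j))
sum-swap zero    m F = sym (sum-zero m (λ _ _ → refl))
sum-swap (suc n) m F = trans (cong (_+ sumBelow m (F n)) (sum-swap n m F))
                             (sym (sum-+ m (λ j → sumBelow n (λ i → F i j)) (F n)))

sum-pad : ∀ n n' (f : ℕ → ℤ) → n ≤ n' → (∀ j → n ≤ j → j < n' → f j ≡ 0ℤ) →
          sumBelow n' f ≡ sumBelow n f
sum-pad n zero     f z≤n h = refl
sum-pad n (suc n') f n≤  h with ℕP.m≤n⇒m<n∨m≡n n≤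
... | inj₂ refl = refl
... | inj₁ (s≤s n≤n') =
  trans (cong₂ _+_ (sum-pad n n' f n≤n' (λ j n≤j j<n' → h j n≤j (ℕP.m<n⇒m<1+n j<n')))
                   (h n' n≤n' ℕP.≤-refl))
        (ℤP.+-identityʳ _)

-- Formal power series as a commutative ring.  Series are compared
-- coefficientwise; all ring laws hold up to this equivalence.

infix 4 _≈_
_≈_ : PS → PS → Set
f ≈ g = ∀ n → f n ≡ g n

≈-refl : ∀ {f} → f ≈ f
≈-refl n = refl

≈-sym : ∀ {f g} → f ≈ g → g ≈ f
≈-sym e n = sym (e n)

≈-trans : ∀ {f g h} → f ≈ g → g ≈ h → f ≈ h
≈-trans e e' n = trans (e n) (e' n)

≡⇒≈ : ∀ {f g} → f ≡ g → f ≈ g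
≡⇒≈ refl = ≈-refl

≈-isEquivalence : B.IsEquivalence _≈_
≈-isEquivalence = record { refl = ≈-refl ; sym = ≈-sym ; trans = ≈-trans }

PSsetoid : Setoid 0ℓ 0ℓ
PSsetoid = record { isEquivalence = ≈-isEquivalence }

module ≈-Reasoning = SetoidReasoning PSsetoid

𝟘 : PS
𝟘 _ = 0ℤ

⊝_ : PS → PS
(⊝ f) n = - f n

infix 8 _•_
_•_ : ℤ → PS → PS
(c • f) n = c * f n

S : PS → PS
S f i = f (suc i)

⊕-cong : ∀ {f f' g g'} → f ≈ f' → g ≈ g' → f ⊕ g ≈ f' ⊕ g'
⊕-cong e e' n = cong₂ _+_ (e n) (e' n)

⊕-congˡ : ∀ {f f'} g → f ≈ f' → f ⊕ g ≈ f' ⊕ g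
⊕-congˡ g e = ⊕-cong e (≈-refl {g})

⊕-congʳ : ∀ f {g g'} → g ≈ g' → f ⊕ g ≈ f ⊕ g'
⊕-congʳ f e = ⊕-cong (≈-refl {f}) e

⊛-congˡ : ∀ {f f'} g → f ≈ f' → f ⊛ g ≈ f' ⊛ g
⊛-congˡ g e n = sum-ext (suc n) (λ i → cong (_* g (n ∸ i)) (e i))

⊛-congʳ : ∀ f {g g'} → g ≈ g' → f ⊛ g ≈ f ⊛ g'
⊛-congʳ f e n = sum-ext (suc n) (λ i → cong (f i *_) (e (n ∸ i)))

⊛-cong : ∀ {f f' g g'} → f ≈ f' → g ≈ g' → f ⊛ g ≈ f' ⊛ g'
⊛-cong {f' = f'} {g = g} e e' = ≈-trans (⊛-congˡ g e) (⊛-congʳ f' e')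

⊛-head : ∀ f g n → (f ⊛ g) (suc n) ≡ f 0 * g (suc n) + (S f ⊛ g) n
⊛-head f g n = sum-front (suc n) (λ i → f i * g (suc n ∸ i))

⊛-last : ∀ f g n → (f ⊛ g) (suc n) ≡ (f ⊛ S g) n + f (suc n) * g 0
⊛-last f g n =
  cong₂ _+_ (sum-cong (suc n) (λ i i≤n →
              cong (λ k → f i * g k) (ℕP.+-∸-assoc 1 (ℕP.≤-pred i≤n))))
            (cong (λ k → f (suc n) * g k) (ℕP.n∸n≡0 n))

⊛-comm : ∀ f g → f ⊛ g ≈ g ⊛ f
⊛-comm f g zero    = cong (0ℤ +_) (ℤP.*-comm (f 0) (g 0))
⊛-comm f g (suc n) = begin
  (f ⊛ g) (suc n)                    ≡⟨ ⊛-head f g n ⟩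
  f 0 * g (suc n) + (S f ⊛ g) n      ≡⟨ cong₂ _+_ (ℤP.*-comm (f 0) (g (suc n))) (⊛-comm (S f) g n) ⟩
  g (suc n) * f 0 + (g ⊛ S f) n      ≡⟨ ℤP.+-comm (g (suc n) * f 0) _ ⟩
  (g ⊛ S f) n + g (suc n) * f 0      ≡⟨ sym (⊛-last g f n) ⟩
  (g ⊛ f) (suc n)                    ∎
  where open ≡-Reasoning

𝟘⊛ : ∀ f → 𝟘 ⊛ f ≈ 𝟘
𝟘⊛ f n = sum-zero (suc n) (λ _ _ → refl)

𝟙⊛ : ∀ f → 𝟙 ⊛ f ≈ f
𝟙⊛ f zero    = trans (ℤP.+-identityˡ (1ℤ * f 0)) (ℤP.*-identityˡ (f 0))
𝟙⊛ f (suc n) = trans (⊛-head 𝟙 f n) (trans (cong (1ℤ * f (suc n) +_) (𝟘⊛ f n)) (unit (f (suc n))))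
  where
  unit : ∀ a → 1ℤ * a + 0ℤ ≡ a
  unit = ℤ-solve

⊛𝟙 : ∀ f → f ⊛ 𝟙 ≈ f
⊛𝟙 f = ≈-trans (⊛-comm f 𝟙) (𝟙⊛ f)

•⊛ : ∀ c f g → (c • f) ⊛ g ≈ c • (f ⊛ g)
•⊛ c f g n = trans (sum-ext (suc n) (λ i → ℤP.*-assoc c (f i) _)) (sym (sum-*ˡ (suc n) c _))

⊕⊛ : ∀ f g h → (f ⊕ g) ⊛ h ≈ f ⊛ h ⊕ g ⊛ h
⊕⊛ f g h n = trans (sum-ext (suc n) (λ i → ℤP.*-distribʳ-+ (h (n ∸ i)) (f i) (g i)))
                   (sum-+ (suc n) _ _)

S-⊛ : ∀ f g → S (f ⊛ g) ≈ f 0 • S g ⊕ S f ⊛ g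
S-⊛ f g n = ⊛-head f g n

⊛-assoc : ∀ f g h → (f ⊛ g) ⊛ h ≈ f ⊛ (g ⊛ h)
⊛-assoc f g h zero = reassoc (f 0) (g 0) (h 0)
  where
  reassoc : ∀ a b c → 0ℤ + (0ℤ + a * b) * c ≡ 0ℤ + a * (0ℤ + b * c)
  reassoc = ℤ-solve
⊛-assoc f g h (suc n) = begin
  ((f ⊛ g) ⊛ h) (suc n)
    ≡⟨ ⊛-head (f ⊛ g) h n ⟩
  (f ⊛ g) 0 * h (suc n) + (S (f ⊛ g) ⊛ h) n
    ≡⟨ cong ((f ⊛ g) 0 * h (suc n) +_)
            (trans (⊛-congˡ h (S-⊛ f g) n) (⊕⊛ (f 0 • S g) (S f ⊛ g) h n)) ⟩
  (f ⊛ g) 0 * h (suc n) + (((f 0 • S g) ⊛ h) n + ((S f ⊛ g) ⊛ h) n)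
    ≡⟨ cong₂ (λ a b → (f ⊛ g) 0 * h (suc n) + (a + b))
             (•⊛ (f 0) (S g) h n) (⊛-assoc (S f) g h n) ⟩
  (0ℤ + f 0 * g 0) * h (suc n) + (f 0 * (S g ⊛ h) n + (S f ⊛ (g ⊛ h)) n)
    ≡⟨ regroup (f 0) (g 0) (h (suc n)) ((S g ⊛ h) n) ((S f ⊛ (g ⊛ h)) n) ⟩
  f 0 * (g 0 * h (suc n) + (S g ⊛ h) n) + (S f ⊛ (g ⊛ h)) n
    ≡⟨ cong (λ a → f 0 * a + (S f ⊛ (g ⊛ h)) n) (sym (⊛-head g h n)) ⟩
  f 0 * (g ⊛ h) (suc n) + (S f ⊛ (g ⊛ h)) n
    ≡⟨ sym (⊛-head f (g ⊛ h) n) ⟩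
  (f ⊛ (g ⊛ h)) (suc n) ∎
  where
  open ≡-Reasoning
  regroup : ∀ a b c d e → (0ℤ + a * b) * c + (a * d + e) ≡ a * (b * c + d) + e
  regroup = ℤ-solve

PSring : CommutativeRing 0ℓ 0ℓ
PSring = record
  { Carrier = PS ; _≈_ = _≈_ ; _+_ = _⊕_ ; _*_ = _⊛_ ; -_ = ⊝_ ; 0# = 𝟘 ; 1# = 𝟙
  ; isCommutativeRing = record
    { isRing = record
      { +-isAbelianGroup = record
        { isGroup = record
          { isMonoid = record
            { isSemigroup = record
              { isMagma = record { isEquivalence = ≈-isEquivalence ; ∙-cong = ⊕-cong }
              ; assoc = λ f g h n → ℤP.+-assoc (f n) (g n) (h n) }
            ; identity = (λ f n → ℤP.+-identityˡ (f n)) , (λ f n → ℤP.+-identityʳ (f n)) }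
          ; inverse = (λ f n → ℤP.+-inverseˡ (f n)) , (λ f n → ℤP.+-inverseʳ (f n))
          ; ⁻¹-cong = λ e n → cong -_ (e n) }
        ; comm = λ f g n → ℤP.+-comm (f n) (g n) }
      ; *-cong = ⊛-cong
      ; *-assoc = ⊛-assoc
      ; *-identity = 𝟙⊛ , ⊛𝟙
      ; distrib = (λ f g h → ≈-trans (⊛-comm f (g ⊕ h))
                               (≈-trans (⊕⊛ g h f) (⊕-cong (⊛-comm g f) (⊛-comm h f))))
                , (λ f g h → ⊕⊛ g h f) }
    ; *-comm = ⊛-comm } }

-- The ring solver for PS, with integer coefficients embedded as constants.

const⊛ : ∀ c g → const c ⊛ g ≈ c • g
const⊛ c g zero    = ℤP.+-identityˡ (c * g 0)
const⊛ c g (suc n) = trans (⊛-head (const c) g n)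
                           (trans (cong (c * g (suc n) +_) (𝟘⊛ g n)) (ℤP.+-identityʳ _))

ℤrawRing : RawRing 0ℓ 0ℓ
ℤrawRing = record { Carrier = ℤ ; _≈_ = _≡_ ; _+_ = _+_ ; _*_ = _*_ ; -_ = -_ ; 0# = 0ℤ ; 1# = 1ℤ }

PSalmostRing : ACR.AlmostCommutativeRing 0ℓ 0ℓ
PSalmostRing = ACR.fromCommutativeRing PSring

const-hom : ℤrawRing ACR.-Raw-AlmostCommutative⟶ PSalmostRing
const-hom = record
  { ⟦_⟧ = const
  ; +-homo = λ c d → λ { zero → refl ; (suc n) → refl }
  ; *-homo = λ c d n → sym (trans (const⊛ c (const d) n) (scale c d n))
  ; -‿homo = λ c → λ { zero → refl ; (suc n) → refl }
  ; 0-homo = λ { zero → refl ; (suc n) → refl }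
  ; 1-homo = ≈-refl }
  where
  scale : ∀ c d n → c * const d n ≡ const (c * d) n
  scale c d zero    = refl
  scale c d (suc n) = ℤP.*-zeroʳ c

const-≟ : ∀ c d → Maybe (const c ≈ const d)
const-≟ c d with c ℤ.≟ d
... | yes refl = just ≈-refl
... | no _     = nothing

open import Algebra.Solver.Ring ℤrawRing PSalmostRing const-hom const-≟
  using (solve; _:=_; con; _:+_; _:*_; _:-_)

-- Inverses.  inv f satisfies the defining recursion of 1/f, hence is a
-- two-sided inverse of f whenever f 0 = 1.

≡ᵇ-refl : ∀ n → (n ≡ᵇ n) ≡ true
≡ᵇ-refl zero    = refl
≡ᵇ-refl (suc n) = ≡ᵇ-refl n

≡ᵇ-< : ∀ {i n} → i < n → (i ≡ᵇ n) ≡ false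
≡ᵇ-< {zero}  {suc n} _         = refl
≡ᵇ-< {suc i} {suc n} (s≤s i<n) = ≡ᵇ-< i<n

inv-at : ∀ f {n i} → i ≤ n → inv f i ≡ invUpTo f n i
inv-at f {zero}  z≤n = refl
inv-at f {suc n} {i} i≤ with ℕP.m≤n⇒m<n∨m≡n i≤
... | inj₂ refl      = refl
... | inj₁ (s≤s i≤n) rewrite ≡ᵇ-< {i} {suc n} (s≤s i≤n) = inv-at f i≤n

inv-suc : ∀ f n → inv f (suc n) ≡ - sumBelow (suc n) (λ j → f (suc j) * inv f (n ∸ j))
inv-suc f n rewrite ≡ᵇ-refl n =
  cong -_ (sum-ext (suc n) (λ j → cong (f (suc j) *_) (sym (inv-at f (ℕP.m∸n≤m n j)))))

inv-inverseʳ : ∀ f → f 0 ≡ 1ℤ → f ⊛ inv f ≈ 𝟙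
inv-inverseʳ f f0≡1 zero rewrite f0≡1 = refl
inv-inverseʳ f f0≡1 (suc n) rewrite ⊛-head f (inv f) n | f0≡1 | inv-suc f n = cancel ((S f ⊛ inv f) n)
  where
  cancel : ∀ a → 1ℤ * - a + a ≡ 0ℤ
  cancel = ℤ-solve

inv-inverseˡ : ∀ f → f 0 ≡ 1ℤ → inv f ⊛ f ≈ 𝟙
inv-inverseˡ f f0≡1 = ≈-trans (⊛-comm (inv f) f) (inv-inverseʳ f f0≡1)

divide : ∀ f {x y} → f 0 ≡ 1ℤ → x ⊛ f ≈ y → x ≈ y ⊛ inv f
divide f {x} {y} f0≡1 xf≈y = begin
  x                  ≈⟨ ≈-sym (⊛𝟙 x) ⟩
  x ⊛ 𝟙              ≈⟨ ⊛-congʳ x (≈-sym (inv-inverseʳ f f0≡1)) ⟩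
  x ⊛ (f ⊛ inv f)    ≈⟨ ≈-sym (⊛-assoc x f (inv f)) ⟩
  (x ⊛ f) ⊛ inv f    ≈⟨ ⊛-congˡ (inv f) xf≈y ⟩
  y ⊛ inv f          ∎
  where open ≈-Reasoning

inv-cong : ∀ {f g} → f ≈ g → inv f ≈ inv g
inv-cong {f} {g} e n = approx-cong n n
  where
  approx-cong : ∀ n → invUpTo f n ≈ invUpTo g n
  approx-cong zero    i = refl
  approx-cong (suc n) i with i ≡ᵇ suc n
  ... | true  = cong -_ (sum-ext (suc n) (λ j → cong₂ _*_ (e (suc j)) (approx-cong n (n ∸ j))))
  ... | false = approx-cong n i

const-⊛ : ∀ f g → f 0 ≡ 1ℤ → g 0 ≡ 1ℤ → (f ⊛ g) 0 ≡ 1ℤ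
const-⊛ f g f0≡1 g0≡1 rewrite f0≡1 | g0≡1 = refl

inv-⊛ : ∀ f g → f 0 ≡ 1ℤ → g 0 ≡ 1ℤ → inv (f ⊛ g) ≈ inv f ⊛ inv g
inv-⊛ f g f0≡1 g0≡1 =
  ≈-sym (≈-trans (divide (f ⊛ g) {inv f ⊛ inv g} {𝟙} (const-⊛ f g f0≡1 g0≡1) product-inverse)
                 (𝟙⊛ (inv (f ⊛ g))))
  where
  regroup : ∀ f g x y → (x ⊛ y) ⊛ (f ⊛ g) ≈ (x ⊛ f) ⊛ (y ⊛ g)
  regroup = solve 4 (λ f g x y → (x :* y) :* (f :* g) := (x :* f) :* (y :* g)) ≈-refl
  product-inverse : (inv f ⊛ inv g) ⊛ (f ⊛ g) ≈ 𝟙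
  product-inverse = ≈-trans (regroup f g (inv f) (inv g))
                   (≈-trans (⊛-cong (inv-inverseˡ f f0≡1) (inv-inverseˡ g g0≡1)) (𝟙⊛ 𝟙))

inv-𝟙 : inv 𝟙 ≈ 𝟙
inv-𝟙 = ≈-sym (≈-trans (divide 𝟙 {𝟙} {𝟙} refl (𝟙⊛ 𝟙)) (𝟙⊛ (inv 𝟙)))

up : PS → PS
up g zero    = 0ℤ
up g (suc n) = g n

q^suc⊛ : ∀ a g → q^ (suc a) ⊛ g ≈ up (q^ a ⊛ g)
q^suc⊛ a g zero    = ℤP.*-zeroˡ (g 0)
q^suc⊛ a g (suc n) rewrite ⊛-head (q^ (suc a)) g n =
  trans (cong (_+ (q^ a ⊛ g) n) (ℤP.*-zeroˡ (g (suc n)))) (ℤP.+-identityˡ _)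

q^-+ : ∀ a b → q^ a ⊛ q^ b ≈ q^ (a ℕ.+ b)
q^-+ zero    b         = 𝟙⊛ (q^ b)
q^-+ (suc a) b zero    = q^suc⊛ a (q^ b) zero
q^-+ (suc a) b (suc n) = trans (q^suc⊛ a (q^ b) (suc n)) (q^-+ a b n)

-- For a ≥ 1, q^a has no constant term (so (q^a;q)_n is invertible).
q^-const : ∀ a .{{_ : NonZero a}} → q^ a 0 ≡ 0ℤ
q^-const (suc a) = refl

Val : ℕ → PS → Set
Val a f = ∀ i → i < a → f i ≡ 0ℤ

val-q^⊛ : ∀ a g → Val a (q^ a ⊛ g)
val-q^⊛ (suc a) g zero    _         = q^suc⊛ a g zero
val-q^⊛ (suc a) g (suc i) (s≤s i<a) = trans (q^suc⊛ a g (suc i)) (val-q^⊛ a g i i<a)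

val-⊛ʳ : ∀ a g f → Val a f → Val a (g ⊛ f)
val-⊛ʳ a g f v i i<a = sum-zero (suc i) (λ j _ →
  trans (cong (g j *_) (v (i ∸ j) (ℕP.≤-<-trans (ℕP.m∸n≤m i j) i<a))) (ℤP.*-zeroʳ (g j)))

val-⊛ˡ : ∀ a f g → Val a f → Val a (f ⊛ g)
val-⊛ˡ a f g v i i<a = trans (⊛-comm f g i) (val-⊛ʳ a g f v i i<a)

val-mono : ∀ {a b} f → a ≤ b → Val b f → Val a f
val-mono f a≤b v i i<a = v i (ℕP.<-≤-trans i<a a≤b)

poch-const : ∀ a → a 0 ≡ 0ℤ → ∀ n → poch a n 0 ≡ 1ℤ
poch-const a a0≡0 zero    = refl
poch-const a a0≡0 (suc n) = const-⊛ (poch a n) (𝟙 ⊖ a ⊛ q^ n) (poch-const a a0≡0 n)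
  (cong (λ x → 1ℤ - (0ℤ + x)) (trans (cong (_* q^ n 0) a0≡0) (ℤP.*-zeroˡ (q^ n 0))))

poch-q^-suc : ∀ a n → poch (q^ a) (suc n) ≈ poch (q^ a) n ⊛ (𝟙 ⊖ q^ (a ℕ.+ n))
poch-q^-suc a n = ⊛-congʳ (poch (q^ a) n) (λ i → cong (_-_ (𝟙 i)) (q^-+ a n i))

-- Sums Σ_{m≥0} t m of families with Val m (t m): only m ≤ N contributes to
-- the coefficient of q^N.

Summable : (ℕ → PS) → Set
Summable t = ∀ m → Val m (t m)

Σ∞ : (ℕ → PS) → PS
Σ∞ t N = sumBelow (suc N) (λ m → t m N)

-- Σ∞ is a linear operation commuting with multiplication (the Summable
-- hypothesis lets the inner sums be padded to a common length).
Σ∞-cong : ∀ {s t} → (∀ m → s m ≈ t m) → Σ∞ s ≈ Σ∞ t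
Σ∞-cong e N = sum-ext (suc N) (λ m → e m N)

Σ∞-⊕ : ∀ s t → Σ∞ (λ m → s m ⊕ t m) ≈ Σ∞ s ⊕ Σ∞ t
Σ∞-⊕ s t N = sum-+ (suc N) _ _

Σ∞-⊛ : ∀ t h → Summable t → Σ∞ t ⊛ h ≈ Σ∞ (λ m → t m ⊛ h)
Σ∞-⊛ t h summable N = begin
  sumBelow (suc N) (λ i → sumBelow (suc i) (λ m → t m i) * h (N ∸ i))
    ≡⟨ sum-cong (suc N) (λ i i≤N → cong (_* h (N ∸ i))
         (sym (sum-pad (suc i) (suc N) (λ m → t m i) i≤N (λ m i<m _ → summable m i i<m)))) ⟩
  sumBelow (suc N) (λ i → sumBelow (suc N) (λ m → t m i) * h (N ∸ i))
    ≡⟨ sum-ext (suc N) (λ i → sum-*ʳ (suc N) (h (N ∸ i)) (λ m → t m i)) ⟩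
  sumBelow (suc N) (λ i → sumBelow (suc N) (λ m → t m i * h (N ∸ i)))
    ≡⟨ sum-swap (suc N) (suc N) (λ i m → t m i * h (N ∸ i)) ⟩
  sumBelow (suc N) (λ m → (t m ⊛ h) N) ∎
  where open ≡-Reasoning

Σ∞-front : ∀ t → Summable t → Σ∞ t ≈ t 0 ⊕ Σ∞ (λ m → t (suc m))
Σ∞-front t summable N = trans (sum-front N (λ m → t m N))
  (cong (t 0 N +_) (sym (trans (cong (sumBelow N (λ m → t (suc m) N) +_)
                                     (summable (suc N) N ℕP.≤-refl))
                               (ℤP.+-identityʳ _))))

sumFrom1≈Σ∞ : ∀ t → (∀ m → Val (suc m) (t (suc m))) → sumFrom1 t ≈ Σ∞ (λ m → t (suc m))
sumFrom1≈Σ∞ t v N = sym (trans (cong (sumFrom1 t N +_) (v N N ℕP.≤-refl)) (ℤP.+-identityʳ _))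

fixpoint : ∀ {E F Q} → E ≈ F ⊕ Q ⊛ E → E ⊛ (𝟙 ⊖ Q) ≈ F
fixpoint {E} {F} {Q} E≈F+QE = begin
  E ⊛ (𝟙 ⊖ Q)                    ≈⟨ expand E Q ⟩
  E ⊖ Q ⊛ E                      ≈⟨ ⊕-congˡ (⊝ (Q ⊛ E)) E≈F+QE ⟩
  (F ⊕ Q ⊛ E) ⊖ Q ⊛ E            ≈⟨ cancel F Q E ⟩
  F                              ∎
  where
  open ≈-Reasoning
  expand : ∀ E Q → E ⊛ (𝟙 ⊖ Q) ≈ E ⊖ Q ⊛ E
  expand = solve 2 (λ E Q → E :* (con 1ℤ :- Q) := E :- Q :* E) ≈-refl
  cancel : ∀ F Q E → (F ⊕ Q ⊛ E) ⊖ Q ⊛ E ≈ F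
  cancel = solve 3 (λ F Q E → (F :+ Q :* E) :- Q :* E := F) ≈-refl

-- Gaussian binomials.  Write p k = (q;q)_k, recip k = 1/(1-q^{k+1}) and
-- Quot M n l = (q;q)_M / ((q;q)_n (q;q)_l); then [l+n, n]_q = Quot (l+n) n l.

p : ℕ → PS
p = poch (q^ 1)

p-const : ∀ k → p k 0 ≡ 1ℤ
p-const = poch-const (q^ 1) refl

recip : ℕ → PS
recip k = inv (𝟙 ⊖ q^ (suc k))

recip-inverse : ∀ k → recip k ⊛ (𝟙 ⊖ q^ (suc k)) ≈ 𝟙
recip-inverse k = inv-inverseˡ (𝟙 ⊖ q^ (suc k)) refl

cancel-recip : ∀ x k → x ⊛ recip k ⊛ (𝟙 ⊖ q^ (suc k)) ≈ x
cancel-recip x k = ≈-trans (⊛-assoc x (recip k) (𝟙 ⊖ q^ (suc k)))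
                           (≈-trans (⊛-congʳ x (recip-inverse k)) (⊛𝟙 x))

inv-p-suc : ∀ k → inv (p (suc k)) ≈ inv (p k) ⊛ recip k
inv-p-suc k = ≈-trans (inv-cong (poch-q^-suc 1 k)) (inv-⊛ (p k) (𝟙 ⊖ q^ (suc k)) (p-const k) refl)

Quot : ℕ → ℕ → ℕ → PS
Quot M n l = p M ⊛ inv (p n) ⊛ inv (p l)

C : ℕ → ℕ → PS
C l n = Quot (l ℕ.+ n) n l

qbin≈C : ∀ k m → qbin (k ℕ.+ m) m ≈ C k m
qbin≈C k m = ⊛-congʳ (p (k ℕ.+ m) ⊛ inv (p m))
                     (≡⇒≈ (cong (λ j → inv (p j)) (ℕP.m+n∸n≡m k m)))

Quot-sucⁿ : ∀ M n l → Quot M (suc n) l ≈ Quot M n l ⊛ recip n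
Quot-sucⁿ M n l = ≈-trans (⊛-congˡ (inv (p l)) (⊛-congʳ (p M) (inv-p-suc n)))
                          (swap (p M) (inv (p n)) (recip n) (inv (p l)))
  where
  swap : ∀ a b c d → a ⊛ (b ⊛ c) ⊛ d ≈ a ⊛ b ⊛ d ⊛ c
  swap = solve 4 (λ a b c d → a :* (b :* c) :* d := a :* b :* d :* c) ≈-refl

Quot-sucˡ : ∀ M n l → Quot M n (suc l) ≈ Quot M n l ⊛ recip l
Quot-sucˡ M n l = ≈-trans (⊛-congʳ (p M ⊛ inv (p n)) (inv-p-suc l))
                          (≈-sym (⊛-assoc (p M ⊛ inv (p n)) (inv (p l)) (recip l)))

Quot-sucᴹ : ∀ M n l → Quot (suc M) n l ≈ Quot M n l ⊛ (𝟙 ⊖ q^ (suc M))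
Quot-sucᴹ M n l = ≈-trans (⊛-congˡ (inv (p l)) (⊛-congˡ (inv (p n)) (poch-q^-suc 1 M)))
                          (swap (p M) (𝟙 ⊖ q^ (suc M)) (inv (p n)) (inv (p l)))
  where
  swap : ∀ a b c d → a ⊛ b ⊛ c ⊛ d ≈ a ⊛ c ⊛ d ⊛ b
  swap = solve 4 (λ a b c d → a :* b :* c :* d := a :* c :* d :* b) ≈-refl

C-zeroʳ : ∀ l → C l 0 ≈ 𝟙
C-zeroʳ l = begin
  p (l ℕ.+ 0) ⊛ inv 𝟙 ⊛ inv (p l)
    ≈⟨ ⊛-congˡ (inv (p l)) (⊛-cong (≡⇒≈ (cong p (ℕP.+-identityʳ l))) inv-𝟙) ⟩
  p l ⊛ 𝟙 ⊛ inv (p l)               ≈⟨ ⊛-congˡ (inv (p l)) (⊛𝟙 (p l)) ⟩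
  p l ⊛ inv (p l)                    ≈⟨ inv-inverseʳ (p l) (p-const l) ⟩
  𝟙                                  ∎
  where open ≈-Reasoning

C-zeroˡ : ∀ n → C 0 n ≈ 𝟙
C-zeroˡ n = ≈-trans (⊛-cong (inv-inverseʳ (p n) (p-const n)) inv-𝟙) (𝟙⊛ 𝟙)

-- The ring identity behind Pascal's rule: (1 - uv)/((1-v)(1-u)) = 1/(1-v) + u/(1-u).
pascal-core : ∀ X Y u v → X ⊛ (𝟙 ⊖ v) ≈ 𝟙 → Y ⊛ (𝟙 ⊖ u) ≈ 𝟙 →
              (𝟙 ⊖ u ⊛ v) ⊛ X ⊛ Y ≈ X ⊕ u ⊛ Y
pascal-core X Y u v X-inv Y-inv = begin
  (𝟙 ⊖ u ⊛ v) ⊛ X ⊛ Y                        ≈⟨ split X Y u v ⟩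
  X ⊛ (Y ⊛ (𝟙 ⊖ u)) ⊕ u ⊛ Y ⊛ (X ⊛ (𝟙 ⊖ v))
    ≈⟨ ⊕-cong (⊛-congʳ X Y-inv) (⊛-congʳ (u ⊛ Y) X-inv) ⟩
  X ⊛ 𝟙 ⊕ u ⊛ Y ⊛ 𝟙                          ≈⟨ ⊕-cong (⊛𝟙 X) (⊛𝟙 (u ⊛ Y)) ⟩
  X ⊕ u ⊛ Y                                  ∎
  where
  open ≈-Reasoning
  split : ∀ X Y u v →
          (𝟙 ⊖ u ⊛ v) ⊛ X ⊛ Y ≈ X ⊛ (Y ⊛ (𝟙 ⊖ u)) ⊕ u ⊛ Y ⊛ (X ⊛ (𝟙 ⊖ v))
  split = solve 4 (λ X Y u v → (con 1ℤ :- u :* v) :* X :* Y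
                               := X :* (Y :* (con 1ℤ :- u)) :+ u :* Y :* (X :* (con 1ℤ :- v))) ≈-refl

pascal : ∀ l n → C (suc l) (suc n) ≈ C l (suc n) ⊕ q^ (suc l) ⊛ C (suc l) n
pascal l n = begin
  C (suc l) (suc n)
    ≈⟨ expand-lhs ⟩
  R ⊛ ((𝟙 ⊖ q^ (suc l) ⊛ q^ (suc n)) ⊛ recip n ⊛ recip l)
    ≈⟨ ⊛-congʳ R (pascal-core (recip n) (recip l) (q^ (suc l)) (q^ (suc n))
                              (recip-inverse n) (recip-inverse l)) ⟩
  R ⊛ (recip n ⊕ q^ (suc l) ⊛ recip l)
    ≈⟨ distribute R (recip n) (q^ (suc l)) (recip l) ⟩
  R ⊛ recip n ⊕ q^ (suc l) ⊛ (R ⊛ recip l)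
    ≈⟨ ⊕-cong (≈-sym (Quot-sucⁿ M n l)) (⊛-congʳ (q^ (suc l)) (≈-sym C-sucˡ)) ⟩
  C l (suc n) ⊕ q^ (suc l) ⊛ C (suc l) n ∎
  where
  open ≈-Reasoning
  -- all three binomials are R = (q;q)_M / ((q;q)_n (q;q)_l) times simple factors
  M = l ℕ.+ suc n
  R = Quot M n l
  factor : 𝟙 ⊖ q^ (suc M) ≈ 𝟙 ⊖ q^ (suc l) ⊛ q^ (suc n)
  factor i = cong (_-_ (𝟙 i)) (sym (q^-+ (suc l) (suc n) i))
  regroup : ∀ r x y z → r ⊛ x ⊛ y ⊛ z ≈ r ⊛ (z ⊛ x ⊛ y)
  regroup = solve 4 (λ r x y z → r :* x :* y :* z := r :* (z :* x :* y)) ≈-refl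
  expand-lhs : C (suc l) (suc n) ≈ R ⊛ ((𝟙 ⊖ q^ (suc l) ⊛ q^ (suc n)) ⊛ recip n ⊛ recip l)
  expand-lhs = begin
    Quot (suc M) (suc n) (suc l)
      ≈⟨ Quot-sucᴹ M (suc n) (suc l) ⟩
    Quot M (suc n) (suc l) ⊛ (𝟙 ⊖ q^ (suc M))
      ≈⟨ ⊛-cong (≈-trans (Quot-sucˡ M (suc n) l) (⊛-congˡ (recip l) (Quot-sucⁿ M n l))) factor ⟩
    R ⊛ recip n ⊛ recip l ⊛ (𝟙 ⊖ q^ (suc l) ⊛ q^ (suc n))
      ≈⟨ regroup R (recip n) (recip l) (𝟙 ⊖ q^ (suc l) ⊛ q^ (suc n)) ⟩
    R ⊛ ((𝟙 ⊖ q^ (suc l) ⊛ q^ (suc n)) ⊛ recip n ⊛ recip l) ∎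
  C-sucˡ : C (suc l) n ≈ R ⊛ recip l
  C-sucˡ = ≈-trans (≡⇒≈ (cong (λ k → Quot k n (suc l)) (sym (ℕP.+-suc l n)))) (Quot-sucˡ M n l)
  distribute : ∀ r x u y → r ⊛ (x ⊕ u ⊛ y) ≈ r ⊛ x ⊕ u ⊛ (r ⊛ y)
  distribute = solve 4 (λ r x u y → r :* (x :+ u :* y) := r :* x :+ u :* (r :* y)) ≈-refl

absorption : ∀ l m → C (suc l) m ⊛ (𝟙 ⊖ q^ (suc l)) ≈ C l (suc m) ⊛ (𝟙 ⊖ q^ (suc m))
absorption l m = begin
  C (suc l) m ⊛ (𝟙 ⊖ q^ (suc l))          ≈⟨ ⊛-congˡ (𝟙 ⊖ q^ (suc l)) (Quot-sucˡ M′ m l) ⟩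
  Quot M′ m l ⊛ recip l ⊛ (𝟙 ⊖ q^ (suc l)) ≈⟨ cancel-recip (Quot M′ m l) l ⟩
  Quot M′ m l                             ≈⟨ ≡⇒≈ (cong (λ k → Quot k m l) (sym (ℕP.+-suc l m))) ⟩
  Quot M m l                              ≈⟨ ≈-sym (cancel-recip (Quot M m l) m) ⟩
  Quot M m l ⊛ recip m ⊛ (𝟙 ⊖ q^ (suc m))  ≈⟨ ⊛-congˡ (𝟙 ⊖ q^ (suc m)) (≈-sym (Quot-sucⁿ M m l)) ⟩
  C l (suc m) ⊛ (𝟙 ⊖ q^ (suc m))          ∎
  where
  open ≈-Reasoning
  -- both sides are (q;q)_{l+m+1} / ((q;q)_m (q;q)_l), with l+m+1 written two ways
  M′ = suc l ℕ.+ m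
  M  = l ℕ.+ suc m

-- The q-binomial theorem  Σ_{m≥0} q^{am} [l+m, m]_q = 1/(q^a;q)_{l+1}  (a ≥ 1).
module QBinomialTheorem (a : ℕ) .{{_ : NonZero a}} where

  term : ℕ → ℕ → PS
  term l m = q^ (a ℕ.* m) ⊛ C l m

  E : ℕ → PS
  E l = Σ∞ (term l)

  -- the m-th term is divisible by q^{am}, hence by q^m
  term-summable : ∀ l → Summable (term l)
  term-summable l m = val-mono (term l m) (ℕP.m≤n*m m a) (val-q^⊛ (a ℕ.* m) (C l m))

  term-zero : ∀ l → term l 0 ≈ 𝟙
  term-zero l = ≈-trans (⊛-cong (≡⇒≈ (cong q^ (ℕP.*-zeroʳ a))) (C-zeroʳ l)) (𝟙⊛ 𝟙)

  term-pascal : ∀ l m → term (suc l) (suc m) ≈ term l (suc m) ⊕ term (suc l) m ⊛ q^ (a ℕ.+ suc l)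
  term-pascal l m = begin
    x′ ⊛ C (suc l) (suc m)
      ≈⟨ ⊛-congʳ x′ (pascal l m) ⟩
    x′ ⊛ (C l (suc m) ⊕ q^ (suc l) ⊛ C (suc l) m)
      ≈⟨ distribute x′ (C l (suc m)) (q^ (suc l)) (C (suc l) m) ⟩
    x′ ⊛ C l (suc m) ⊕ (x′ ⊛ q^ (suc l)) ⊛ C (suc l) m
      ≈⟨ ⊕-congʳ (x′ ⊛ C l (suc m)) (⊛-congˡ (C (suc l) m) monomials) ⟩
    x′ ⊛ C l (suc m) ⊕ (q^ (a ℕ.+ suc l) ⊛ x) ⊛ C (suc l) m
      ≈⟨ ⊕-congʳ (x′ ⊛ C l (suc m)) (rotate (q^ (a ℕ.+ suc l)) x (C (suc l) m)) ⟩
    term l (suc m) ⊕ term (suc l) m ⊛ q^ (a ℕ.+ suc l) ∎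
    where
    open ≈-Reasoning
    x′ = q^ (a ℕ.* suc m)
    x  = q^ (a ℕ.* m)
    exponents : ∀ a m l → a ℕ.* suc m ℕ.+ suc l ≡ a ℕ.+ suc l ℕ.+ a ℕ.* m
    exponents = ℕ-solve
    monomials : x′ ⊛ q^ (suc l) ≈ q^ (a ℕ.+ suc l) ⊛ x
    monomials = ≈-trans (q^-+ (a ℕ.* suc m) (suc l))
                (≈-trans (≡⇒≈ (cong q^ (exponents a m l))) (≈-sym (q^-+ (a ℕ.+ suc l) (a ℕ.* m))))
    distribute : ∀ x b u c → x ⊛ (b ⊕ u ⊛ c) ≈ x ⊛ b ⊕ (x ⊛ u) ⊛ c
    distribute = solve 4 (λ x b u c → x :* (b :+ u :* c) := x :* b :+ (x :* u) :* c) ≈-refl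
    rotate : ∀ u x c → (u ⊛ x) ⊛ c ≈ (x ⊛ c) ⊛ u
    rotate = solve 3 (λ u x c → (u :* x) :* c := (x :* c) :* u) ≈-refl

  E-zero-fixpoint : E 0 ≈ 𝟙 ⊕ q^ a ⊛ E 0
  E-zero-fixpoint = begin
    E 0                                  ≈⟨ Σ∞-front (term 0) (term-summable 0) ⟩
    term 0 0 ⊕ Σ∞ (λ m → term 0 (suc m)) ≈⟨ ⊕-cong (term-zero 0) (Σ∞-cong shift) ⟩
    𝟙 ⊕ Σ∞ (λ m → term 0 m ⊛ q^ a)       ≈⟨ ⊕-congʳ 𝟙 (≈-sym (Σ∞-⊛ (term 0) (q^ a) (term-summable 0))) ⟩
    𝟙 ⊕ E 0 ⊛ q^ a                       ≈⟨ ⊕-congʳ 𝟙 (⊛-comm (E 0) (q^ a)) ⟩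
    𝟙 ⊕ q^ a ⊛ E 0                       ∎
    where
    open ≈-Reasoning
    monomial : ∀ m → term 0 m ≈ q^ (a ℕ.* m)
    monomial m = ≈-trans (⊛-congʳ (q^ (a ℕ.* m)) (C-zeroˡ m)) (⊛𝟙 (q^ (a ℕ.* m)))
    exponents : ∀ a m → a ℕ.* suc m ≡ a ℕ.* m ℕ.+ a
    exponents = ℕ-solve
    shift : ∀ m → term 0 (suc m) ≈ term 0 m ⊛ q^ a
    shift m = ≈-trans (monomial (suc m)) (≈-trans (≡⇒≈ (cong q^ (exponents a m)))
              (≈-trans (≈-sym (q^-+ (a ℕ.* m) a)) (⊛-congˡ (q^ a) (≈-sym (monomial m)))))

  -- Summing Pascal's rule over m: E_{l+1} = E_l + q^{a+l+1} E_{l+1}.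
  E-suc-fixpoint : ∀ l → E (suc l) ≈ E l ⊕ q^ (a ℕ.+ suc l) ⊛ E (suc l)
  E-suc-fixpoint l = begin
    E (suc l)
      ≈⟨ Σ∞-front (term (suc l)) (term-summable (suc l)) ⟩
    term (suc l) 0 ⊕ Σ∞ (λ m → term (suc l) (suc m))
      ≈⟨ ⊕-cong (≈-trans (term-zero (suc l)) (≈-sym (term-zero l))) (Σ∞-cong (term-pascal l)) ⟩
    term l 0 ⊕ Σ∞ (λ m → term l (suc m) ⊕ term (suc l) m ⊛ Q)
      ≈⟨ ⊕-congʳ (term l 0) (Σ∞-⊕ (λ m → term l (suc m)) (λ m → term (suc l) m ⊛ Q)) ⟩
    term l 0 ⊕ (Σ∞ (λ m → term l (suc m)) ⊕ Σ∞ (λ m → term (suc l) m ⊛ Q))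
      ≈⟨ ⊕-congʳ (term l 0) (⊕-congʳ (Σ∞ (λ m → term l (suc m)))
                                      (≈-sym (Σ∞-⊛ (term (suc l)) Q (term-summable (suc l))))) ⟩
    term l 0 ⊕ (Σ∞ (λ m → term l (suc m)) ⊕ E (suc l) ⊛ Q)
      ≈⟨ regroup (term l 0) (Σ∞ (λ m → term l (suc m))) (E (suc l)) Q ⟩
    (term l 0 ⊕ Σ∞ (λ m → term l (suc m))) ⊕ Q ⊛ E (suc l)
      ≈⟨ ⊕-congˡ (Q ⊛ E (suc l)) (≈-sym (Σ∞-front (term l) (term-summable l))) ⟩
    E l ⊕ Q ⊛ E (suc l) ∎
    where
    open ≈-Reasoning
    Q = q^ (a ℕ.+ suc l)
    regroup : ∀ b c e u → b ⊕ (c ⊕ e ⊛ u) ≈ (b ⊕ c) ⊕ u ⊛ e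
    regroup = solve 4 (λ b c e u → b :+ (c :+ e :* u) := (b :+ c) :+ u :* e) ≈-refl

  E-poch : ∀ l → E l ⊛ poch (q^ a) (suc l) ≈ 𝟙
  E-poch zero = begin
    E 0 ⊛ poch (q^ a) 1
      ≈⟨ ⊛-congʳ (E 0) (≈-trans (poch-q^-suc a 0) (𝟙⊛ (𝟙 ⊖ q^ (a ℕ.+ 0)))) ⟩
    E 0 ⊛ (𝟙 ⊖ q^ (a ℕ.+ 0))
      ≈⟨ ⊛-congʳ (E 0) (≡⇒≈ (cong (λ k → 𝟙 ⊖ q^ k) (ℕP.+-identityʳ a))) ⟩
    E 0 ⊛ (𝟙 ⊖ q^ a)
      ≈⟨ fixpoint {E 0} {𝟙} {q^ a} E-zero-fixpoint ⟩
    𝟙 ∎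
    where open ≈-Reasoning
  E-poch (suc l) = begin
    E (suc l) ⊛ poch (q^ a) (suc (suc l))
      ≈⟨ ⊛-congʳ (E (suc l)) (poch-q^-suc a (suc l)) ⟩
    E (suc l) ⊛ (poch (q^ a) (suc l) ⊛ (𝟙 ⊖ q^ (a ℕ.+ suc l)))
      ≈⟨ swap (E (suc l)) (poch (q^ a) (suc l)) (𝟙 ⊖ q^ (a ℕ.+ suc l)) ⟩
    E (suc l) ⊛ (𝟙 ⊖ q^ (a ℕ.+ suc l)) ⊛ poch (q^ a) (suc l)
      ≈⟨ ⊛-congˡ (poch (q^ a) (suc l))
                 (fixpoint {E (suc l)} {E l} {q^ (a ℕ.+ suc l)} (E-suc-fixpoint l)) ⟩
    E l ⊛ poch (q^ a) (suc l)
      ≈⟨ E-poch l ⟩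
    𝟙 ∎
    where
    open ≈-Reasoning
    swap : ∀ e b c → e ⊛ (b ⊛ c) ≈ e ⊛ c ⊛ b
    swap = solve 3 (λ e b c → e :* (b :* c) := e :* c :* b) ≈-refl

  q-binomial-theorem : ∀ l → E l ≈ inv (poch (q^ a) (suc l))
  q-binomial-theorem l =
    ≈-trans (divide (poch (q^ a) (suc l)) {E l} {𝟙} (poch-const (q^ a) (q^-const a) (suc l)) (E-poch l))
            (𝟙⊛ (inv (poch (q^ a) (suc l))))

  q-binomial-tail : ∀ l → Σ∞ (λ m → term l (suc m)) ≈ inv (poch (q^ a) (suc l)) ⊖ 𝟙
  q-binomial-tail l N = begin
    Σ∞ (λ m → term l (suc m)) N
      ≡⟨ isolate (E l N) (term l 0 N) _ (Σ∞-front (term l) (term-summable l) N) ⟩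
    E l N - term l 0 N
      ≡⟨ cong₂ _-_ (q-binomial-theorem l N) (term-zero l N) ⟩
    (inv (poch (q^ a) (suc l)) ⊖ 𝟙) N ∎
    where
    open ≡-Reasoning
    cancel : ∀ b c → c ≡ b + c - b
    cancel = ℤ-solve
    isolate : ∀ e b c → e ≡ b + c → c ≡ e - b
    isolate e b c refl = cancel b c

open QBinomialTheorem 3 using (term; term-summable; q-binomial-tail)

summand : ℕ → ℕ → PS
summand L n = q^ (3 ℕ.* n) ⊛ inv (𝟙 ⊖ q^ n) ⊛ qbin (L ℕ.+ n ∸ 1) (n ∸ 1)

summand-val : ∀ L m → Val (suc m) (summand L (suc m))
summand-val L m = val-mono (summand L (suc m)) (ℕP.m≤n*m (suc m) 3)
  (val-⊛ˡ (3 ℕ.* suc m) (q^ (3 ℕ.* suc m) ⊛ recip m) (qbin (L ℕ.+ suc m ∸ 1) m)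
          (val-q^⊛ (3 ℕ.* suc m) (recip m)))

-- By absorption, (1 - q^{l+1}) times the n-th summand is q^{3n} [l+n, n].
summand-absorb : ∀ l m → summand (suc l) (suc m) ⊛ (𝟙 ⊖ q^ (suc l)) ≈ term l (suc m)
summand-absorb l m = begin
  x ⊛ recip m ⊛ qbin (l ℕ.+ suc m) m ⊛ D
    ≈⟨ ⊛-congˡ D (⊛-congʳ (x ⊛ recip m) (≈-trans (≡⇒≈ (cong (λ k → qbin k m) (ℕP.+-suc l m)))
                                                 (qbin≈C (suc l) m))) ⟩
  x ⊛ recip m ⊛ C (suc l) m ⊛ D
    ≈⟨ ⊛-assoc (x ⊛ recip m) (C (suc l) m) D ⟩
  x ⊛ recip m ⊛ (C (suc l) m ⊛ D)
    ≈⟨ ⊛-congʳ (x ⊛ recip m) (absorption l m) ⟩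
  x ⊛ recip m ⊛ (C l (suc m) ⊛ (𝟙 ⊖ q^ (suc m)))
    ≈⟨ regroup x (recip m) (C l (suc m)) (𝟙 ⊖ q^ (suc m)) ⟩
  x ⊛ C l (suc m) ⊛ (recip m ⊛ (𝟙 ⊖ q^ (suc m)))
    ≈⟨ ≈-trans (⊛-congʳ (x ⊛ C l (suc m)) (recip-inverse m)) (⊛𝟙 (term l (suc m))) ⟩
  term l (suc m) ∎
  where
  open ≈-Reasoning
  x = q^ (3 ℕ.* suc m)
  D = 𝟙 ⊖ q^ (suc l)
  regroup : ∀ x r c d → x ⊛ r ⊛ (c ⊛ d) ≈ x ⊛ c ⊛ (r ⊛ d)
  regroup = solve 4 (λ x r c d → x :* r :* (c :* d) := x :* c :* (r :* d)) ≈-refl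

sum-absorb : ∀ l → sumFrom1 (summand (suc l)) ⊛ (𝟙 ⊖ q^ (suc l)) ≈ inv (poch (q^ 3) (suc l)) ⊖ 𝟙
sum-absorb l = begin
  sumFrom1 (summand (suc l)) ⊛ D              ≈⟨ ⊛-congˡ D (sumFrom1≈Σ∞ (summand (suc l)) (summand-val (suc l))) ⟩
  Σ∞ (λ m → summand (suc l) (suc m)) ⊛ D      ≈⟨ Σ∞-⊛ (λ m → summand (suc l) (suc m)) D summable ⟩
  Σ∞ (λ m → summand (suc l) (suc m) ⊛ D)      ≈⟨ Σ∞-cong (summand-absorb l) ⟩
  Σ∞ (λ m → term l (suc m))                   ≈⟨ q-binomial-tail l ⟩
  inv (poch (q^ 3) (suc l)) ⊖ 𝟙               ∎
  where
  open ≈-Reasoning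
  D = 𝟙 ⊖ q^ (suc l)
  summable : Summable (λ m → summand (suc l) (suc m))
  summable m = val-mono (summand (suc l) (suc m)) (ℕP.n≤1+n m) (summand-val (suc l) m)

G-absorb : ∀ l → G (suc l) ⊛ (𝟙 ⊖ q^ (suc l)) ≈ H* (suc l)
G-absorb l = ≈-trans (distribute (q^ 2) P T D)
                     (⊕-congʳ (q^ 2 ⊛ D ⊛ P) (λ n → cong -_ (sum-absorb l n)))
  where
  P = inv (poch (q^ 2) (suc (suc l)))
  T = sumFrom1 (summand (suc l))
  D = 𝟙 ⊖ q^ (suc l)
  distribute : ∀ A P T D → (A ⊛ P ⊖ T) ⊛ D ≈ A ⊛ D ⊛ P ⊖ T ⊛ D
  distribute = solve 4 (λ A P T D → (A :* P :- T) :* D := A :* D :* P :- T :* D) ≈-refl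

theorem5p2 : (L : ℕ) → 3 ≤ L → (N : ℕ) → G L N ≡ (H* L ⊛ inv (𝟙 ⊖ q^ L)) N
theorem5p2 (suc l) _ = divide (𝟙 ⊖ q^ (suc l)) {G (suc l)} {H* (suc l)} refl (G-absorb l)
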